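{- For every finite field $\mathbb{F}_q$, $\mathrm{BP}_1(\mathrm{GAL}_{G_q})\ge 2^{q-1}$.
   Context: For $(i,j)\in\mathbb{F}_q^2$ let $\ell_{(i,j)}=\{(t,i+jt):t\in\mathbb{F}_q\}$ (the non-vertical lines). $G_q$ is the bipartite graph with parts $A=B=\mathbb{F}_q^2$ in which $a\in A$ is adjacent to $b\in B$ iff $a\in\ell_b$. $\mathrm{GAL}_{G_q}:\{0,1\}^A\to\{0,1\}$ treats $x$ as a subset of points and equals $1$ iff $x$ meets every non-vertical line (equivalently, the neighbourhood of $x$ is all of $B$). $\mathrm{BP}_1(f)$ is the minimum number of nodes of a deterministic branching program (DAG with one source, sinks labelled 0/1, nodes labelled by variables with edges for the two values) computing $f$ in which every variable is read at most once on each source-to-sink path. -}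

module Defs where

open import Level using (0ℓ)
open import Data.Nat using (ℕ; _<_; _≤_; _∸_; _^_)
open import Data.Fin using (Fin; toℕ) renaming (zero to fzero)
open import Data.Bool using (Bool; true; false; if_then_else_)
open import Data.Product using (Σ; ∃; ∃-syntax; _×_; _,_)
open import Data.Sum using (_⊎_)
open import Data.List using (List; []; _∷_)
open import Data.List.Relation.Unary.AllPairs using (AllPairs)
open import Relation.Nullary using (¬_)
open import Relation.Binary.PropositionalEquality using (_≡_; _≢_)
import Algebra.Structures as AS
open import Function.Bundles using (_↔_)

record FiniteField : Set₁ where
  field
    Carrier : Set
    _+_ _*_ : Carrier → Carrier → Carrier
    -_      : Carrier → Carrier
    0# 1#   : Carrier
    isCommutativeRing :
      AS.IsCommutativeRing {A = Carrier} _≡_ _+_ _*_ -_ 0# 1#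
    0≢1     : 0# ≢ 1#
    inverse : ∀ x → x ≢ 0# → ∃[ y ] (x * y ≡ 1#)
    q       : ℕ
    enum    : Carrier ↔ Fin q

-- Acyclicity is encoded by a topological numbering: every edge goes from
-- a node to a node with strictly larger index.

data NodeLabel (V : Set) (n : ℕ) : Set where
  sink  : Bool → NodeLabel V n
  query : V → (on0 on1 : Fin n) → NodeLabel V n

record BP (V : Set) : Set where
  field
    size   : ℕ
    label  : Fin size → NodeLabel V size
    acyclic : ∀ i v j0 j1 → label i ≡ query v j0 j1 →
              (toℕ i < toℕ j0) × (toℕ i < toℕ j1)
    source : Fin size
    source-is-0 : toℕ source ≡ 0

module _ {V : Set} (P : BP V) where
  open BP P

  data Run (x : V → Bool) : Fin size → Bool → Set where
    at-sink : ∀ {i b} → label i ≡ sink b → Run x i b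
    step    : ∀ {i v j0 j1 b} → label i ≡ query v j0 j1 →
              Run x (if x v then j1 else j0) b → Run x i b

  data PathToSink : Fin size → List V → Set where
    end  : ∀ {i b} → label i ≡ sink b → PathToSink i []
    edge : ∀ {i v j0 j1 vs} (c : Bool) → label i ≡ query v j0 j1 →
           PathToSink (if c then j1 else j0) vs → PathToSink i (v ∷ vs)

  ReadOnce : Set
  ReadOnce = ∀ vs → PathToSink source vs → AllPairs _≢_ vs

  Computes : ((V → Bool) → Set) → Set
  Computes f = ∀ x → (Run x source true × f x) ⊎ (Run x source false × ¬ f x)

module _ (F : FiniteField) where
  open FiniteField F

  Point : Set
  Point = Carrier × Carrier

  -- a ∈ ℓ_b  for b = (i , j):  a = (t , i + j t) for some t.
  OnLine : Point → Point → Set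
  OnLine (a₁ , a₂) (i , j) = a₂ ≡ i + (j * a₁)

  GAL : (Point → Bool) → Set
  GAL x = ∀ (b : Point) → ∃[ a ] (OnLine a b × x a ≡ true)

BP₁≥ : {V : Set} → ((V → Bool) → Set) → ℕ → Set
BP₁≥ {V} f m = ∀ (P : BP V) → ReadOnce P → Computes P f → m ≤ BP.size P

-- Follow a read-once program computing GAL from its source along a bit string
-- of length at most q − 2. The points queried on the way form a partial
-- assignment that does not yet decide GAL: it extends by zeros on a horizontal
-- line through no assigned point, and by ones. If two different strings led to
-- the same node, they first part at a query of some point p. Take a line L
-- through p containing no other point assigned on the walk that sets p to 0,
-- and complete both walks' assignments by the input vanishing exactly on L.
-- The first completion vanishes on L, so GAL fails; the second satisfies GAL
-- (L at p, every other line at one of two points with fresh abscissae). Yet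
-- they agree on every variable read after the common node, since the program
-- is read-once. So the 2^(q−1) − 1 strings reach distinct non-sink nodes, and
-- a sink exists too.
module Submission where

open import Defs
open import Level using (0ℓ)
open import Data.Nat as ℕ
  using (ℕ; zero; suc; _≤_; _<_; _∸_; _^_; z≤n; s≤s)
open import Data.Nat.Properties
  using (≤-refl; ≤-trans; ≤-reflexive; <⇒≤; <-≤-trans; <-irrefl; <⇒≱; n≤1+n;
         +-monoʳ-≤; m+[n∸m]≡n; ≤-irrelevant)
open import Data.Fin as Fin using (Fin; toℕ; remQuot; combine)
open import Data.Fin.Properties using (combine-remQuot; injective⇒≤; all?; any?; ¬∀⟶∃¬; inj⇒≟)
open import Data.Fin.Induction using (>-wellFounded)
open import Data.Fin.Patterns using (0F; 1F)
open import Data.Bool using (Bool; true; false; not; if_then_else_)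
open import Data.Bool.Properties using () renaming (_≟_ to _≟ᵇ_)
open import Data.Maybe as Maybe using (Maybe; just; nothing; maybe′)
open import Data.Maybe.Properties using (map-injective; just-injective)
open import Data.List using (List; []; _∷_; _++_; _∷ʳ_; length; map; lookup)
open import Data.List.Properties using (length-map; length-++-≤ˡ; ∷ʳ-++) renaming (≡-dec to List-≡-dec)
open import Data.List.Relation.Unary.All as All using (All; []; _∷_)
import Data.List.Relation.Unary.All.Properties as All
open import Data.List.Relation.Unary.AllPairs using (AllPairs; []; _∷_)
open import Data.List.Relation.Unary.Any using (here; there; index)
open import Data.List.Relation.Unary.Any.Properties using (lookup-index)
open import Data.List.Membership.Propositional using (_∈_; _∉_)
open import Data.List.Membership.Propositional.Properties using (∈-map⁺; ∈-map⁻)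
import Data.List.Membership.DecPropositional as DecMembership
open import Data.Product using (Σ-syntax; ∃-syntax; ∃₂; _×_; _,_; -,_; proj₁; proj₂; uncurry; map₂)
open import Data.Product.Properties using (×-≡,≡→≡; ≡-dec)
open import Data.Sum using (_⊎_; inj₁; inj₂; [_,_]′)
import Data.Sum as Sum
open import Data.Empty using (⊥; ⊥-elim)
open import Function using (_∘_)
open import Function.Definitions using (Injective)
open import Function.Bundles using (Inverse)
open import Function.Properties.Inverse using (↔⇒↣)
open import Induction.WellFounded using (Acc; acc)
open import Relation.Nullary using (¬_; Dec; yes; no; does; contradiction)
open import Relation.Nullary.Decidable using (_×-dec_; ¬?; dec-true; dec-false)
open import Relation.Binary.Definitions using (DecidableEquality)
open import Relation.Binary.PropositionalEquality hiding ([_])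
import Algebra.Bundles as Bundles
import Algebra.Properties.Group as GroupProperties

Bits≤ : ℕ → Set
Bits≤ m = Σ[ bs ∈ List Bool ] length bs ≤ m

push : ∀ {m} → Bool → Bits≤ m → Bits≤ (suc m)
push b (bs , h) = b ∷ bs , s≤s h

push-injective : ∀ {m} b → Injective _≡_ _≡_ (push {m} b)
push-injective b refl = refl

-- Maybe (Bits≤ (suc m)) is two copies of Maybe (Bits≤ m): nothing and the
-- strings starting with false, and the empty string and those starting with true.
extend : ∀ {m} → Fin 2 → Maybe (Bits≤ m) → Maybe (Bits≤ (suc m))
extend 0F = Maybe.map (push false)
extend 1F = just ∘ maybe′ (push true) ([] , z≤n)

extend-disjoint : ∀ {m} (o o' : Maybe (Bits≤ m)) → extend 0F o ≢ extend 1F o'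
extend-disjoint nothing  _        ()
extend-disjoint (just _) nothing  ()
extend-disjoint (just _) (just _) ()

extend-injective : ∀ {m} b b' (o o' : Maybe (Bits≤ m)) →
                   extend b o ≡ extend b' o' → (b , o) ≡ (b' , o')
extend-injective 0F 0F _        _        e  = cong (0F ,_) (map-injective (push-injective false) e)
extend-injective 0F 1F o        o'       e  = ⊥-elim (extend-disjoint o o' e)
extend-injective 1F 0F o        o'       e  = ⊥-elim (extend-disjoint o' o (sym e))
extend-injective 1F 1F nothing  nothing  _  = refl
extend-injective 1F 1F (just _) (just _) e  = cong (λ s → 1F , just s) (push-injective true (just-injective e))
extend-injective 1F 1F nothing  (just _) ()
extend-injective 1F 1F (just _) nothing  ()

decode : ∀ m → Fin (2 ^ suc m) → Maybe (Bits≤ m)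
decode zero    0F = nothing
decode zero    1F = just ([] , z≤n)
decode (suc m) i  = uncurry extend (map₂ (decode m) (remQuot {2} (2 ^ suc m) i))

remQuot-injective : ∀ {n} k {i j : Fin (n ℕ.* k)} → remQuot {n} k i ≡ remQuot k j → i ≡ j
remQuot-injective {n} k {i} {j} e =
  trans (sym (combine-remQuot {n} k i)) (trans (cong (uncurry combine) e) (combine-remQuot {n} k j))

decode-injective : ∀ m → Injective _≡_ _≡_ (decode m)
decode-injective zero {0F} {0F} _  = refl
decode-injective zero {1F} {1F} _  = refl
decode-injective zero {0F} {1F} ()
decode-injective zero {1F} {0F} ()
decode-injective (suc m) e =
  remQuot-injective {2} (2 ^ suc m)
    (×-≡,≡→≡ (cong proj₁ halves , decode-injective m (cong proj₂ halves)))
  where halves = extend-injective _ _ _ _ e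

maybe′-injective : ∀ {A B : Set} {f : A → B} {z : B} →
                   Injective _≡_ _≡_ f → (∀ a → f a ≢ z) → Injective _≡_ _≡_ (maybe′ f z)
maybe′-injective f-inj f≢z {just a}  {just a'} e = cong just (f-inj e)
maybe′-injective f-inj f≢z {just a}  {nothing} e = ⊥-elim (f≢z a e)
maybe′-injective f-inj f≢z {nothing} {just a'} e = ⊥-elim (f≢z a' (sym e))
maybe′-injective f-inj f≢z {nothing} {nothing} e = refl

Bits≤-injection⇒≤ : ∀ {m n} (f : Maybe (Bits≤ m) → Fin n) → Injective _≡_ _≡_ f → 2 ^ suc m ≤ n
Bits≤-injection⇒≤ {m} f f-inj = injective⇒≤ (decode-injective m ∘ f-inj)

module _ {V : Set} where

  vars : List (V × Bool) → List V
  vars = map proj₁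

  Extends : (V → Bool) → List (V × Bool) → Set
  Extends x = All (λ (v , b) → x v ≡ b)

  Disagree : List (V × Bool) → List (V × Bool) → Set
  Disagree A A' = ∃[ v ] ((v , false) ∈ A × (v , true) ∈ A')

  Disagree-∷ : ∀ {a a' A A'} → Disagree A A' → Disagree (a ∷ A) (a' ∷ A')
  Disagree-∷ (v , p , p') = v , there p , there p'

  AllPairs-++⁻ˡ : ∀ {R : V → V → Set} xs {ys} → AllPairs R (xs ++ ys) → AllPairs R xs
  AllPairs-++⁻ˡ []       _          = []
  AllPairs-++⁻ˡ (x ∷ xs) (rx ∷ rxs) = All.++⁻ˡ xs rx ∷ AllPairs-++⁻ˡ xs rxs

  AllPairs-++⇒∉ : ∀ (xs : List V) {ys} → AllPairs _≢_ (xs ++ ys) → All (_∉ xs) ys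
  AllPairs-++⇒∉ []       _          = All.universal (λ _ ()) _
  AllPairs-++⇒∉ (x ∷ xs) (rx ∷ rxs) =
    All.zipWith (λ (x≢y , y∉xs) → λ { (here y≡x) → x≢y (sym y≡x) ; (there y∈xs) → y∉xs y∈xs })
                (All.++⁻ʳ xs rx , AllPairs-++⇒∉ xs rxs)

  module _ (_≟_ : DecidableEquality V) where

    override : List (V × Bool) → (V → Bool) → V → Bool
    override []            d s = d s
    override ((v , b) ∷ A) d s = if does (s ≟ v) then b else override A d s

    override-∉ : ∀ A d {s} → s ∉ vars A → override A d s ≡ d s
    override-∉ []            d _   = refl
    override-∉ ((v , b) ∷ A) d {s} s∉ with s ≟ v
    ... | yes s≡v = contradiction (here s≡v) s∉
    ... | no  _   = override-∉ A d (s∉ ∘ there)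

    override-extends : ∀ A d → AllPairs _≢_ (vars A) → Extends (override A d) A
    override-extends []            d []          = []
    override-extends ((v , b) ∷ A) d (v∉A ∷ dA) =
      head ∷ All.map untouched (All.zip (override-extends A d dA , All.map⁻ v∉A))
      where
      head : override ((v , b) ∷ A) d v ≡ b
      head rewrite dec-true (v ≟ v) refl = refl
      untouched : ∀ {(w , c) : V × Bool} → override A d w ≡ c × v ≢ w →
                  override ((v , b) ∷ A) d w ≡ c
      untouched {w , _} (eq , v≢w) rewrite dec-false (w ≟ v) (v≢w ∘ sym) = eq

module _ {V : Set} (P : BP V) where
  open BP P

  data Walk : Fin size → List Bool → Fin size → List (V × Bool) → Set where
    stay : ∀ {i} → Walk i [] i []
    move : ∀ {i v j₀ j₁ bs k A} (b : Bool) → label i ≡ query v j₀ j₁ →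
           Walk (if b then j₁ else j₀) bs k A → Walk i (b ∷ bs) k ((v , b) ∷ A)

  walk-length : ∀ {i bs k A} → Walk i bs k A → length A ≡ length bs
  walk-length stay         = refl
  walk-length (move _ _ w) = cong suc (walk-length w)

  walk-snoc : ∀ {i bs k A v j₀ j₁} → Walk i bs k A → label k ≡ query v j₀ j₁ → (b : Bool) →
              Walk i (bs ∷ʳ b) (if b then j₁ else j₀) (A ∷ʳ (v , b))
  walk-snoc stay          e b = move b e stay
  walk-snoc (move c e' w) e b = move c e' (walk-snoc w e b)

  successor-above : ∀ {i v j₀ j₁} → label i ≡ query v j₀ j₁ →
                    ∀ b → toℕ i < toℕ (if b then j₁ else j₀)
  successor-above e false = proj₁ (acyclic _ _ _ _ e)
  successor-above e true  = proj₂ (acyclic _ _ _ _ e)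

  walk-monotone : ∀ {i bs k A} → Walk i bs k A → toℕ i ≤ toℕ k
  walk-monotone stay         = ≤-refl
  walk-monotone (move b e w) = ≤-trans (<⇒≤ (successor-above e b)) (walk-monotone w)

  walk-nonempty-irrefl : ∀ {i b bs A} → ¬ Walk i (b ∷ bs) i A
  walk-nonempty-irrefl (move b e w) = <-irrefl refl (<-≤-trans (successor-above e b) (walk-monotone w))

  walks-disagree : ∀ {i bs bs' k A A'} → Walk i bs k A → Walk i bs' k A' → bs ≢ bs' →
                   Disagree A A' ⊎ Disagree A' A
  walks-disagree stay            stay            bs≢bs' = contradiction refl bs≢bs'
  walks-disagree stay            w'@(move _ _ _) _      = contradiction w' walk-nonempty-irrefl
  walks-disagree w@(move _ _ _)  stay            _      = contradiction w walk-nonempty-irrefl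
  walks-disagree (move b e w) (move b' e' w') bs≢bs' with refl ← trans (sym e) e' with b | b'
  ... | false | true  = inj₁ (-, here refl , here refl)
  ... | true  | false = inj₂ (-, here refl , here refl)
  ... | false | false = Sum.map Disagree-∷ Disagree-∷ (walks-disagree w w' (bs≢bs' ∘ cong (false ∷_)))
  ... | true  | true  = Sum.map Disagree-∷ Disagree-∷ (walks-disagree w w' (bs≢bs' ∘ cong (true ∷_)))

  path-to-sink : ∀ i → ∃[ vs ] PathToSink P i vs
  path-to-sink i = go i (>-wellFounded i)
    where
    go : ∀ i → Acc Fin._>_ i → ∃[ vs ] PathToSink P i vs
    go i (acc rs) with label i in e
    ... | sink _        = [] , end e
    ... | query v j₀ j₁ with vs , p ← go j₀ (rs (successor-above e false)) = v ∷ vs , edge false e p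

  walk→path : ∀ {i bs k A vs} → Walk i bs k A → PathToSink P k vs → PathToSink P i (vars A ++ vs)
  walk→path stay         p = p
  walk→path (move b e w) p = edge b e (walk→path w p)

  follow : ∀ {x i bs k A c} → Extends x A → Walk i bs k A → Run P x i c → Run P x k c
  follow _           stay         r              = r
  follow _           (move _ e _) (at-sink e')   with () ← trans (sym e) e'
  follow (xv≡b ∷ x⊇A) (move b e w) (step e' r) with refl ← trans (sym e) e' rewrite xv≡b =
    follow x⊇A w r

  sink-output : ∀ {x k c c'} → label k ≡ sink c → Run P x k c' → c' ≡ c
  sink-output e (at-sink e') with refl ← trans (sym e) e' = refl
  sink-output e (step e' _)  with () ← trans (sym e) e'

  run-sink : ∀ {x i c} → Run P x i c → ∃[ k ] label k ≡ sink c
  run-sink (at-sink e) = -, e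
  run-sink (step _ r)  = run-sink r

  runs-agree : ∀ {x y k c c'} → (∀ {vs} → PathToSink P k vs → All (λ v → x v ≡ y v) vs) →
               Run P x k c → Run P y k c' → c ≡ c'
  runs-agree agree (at-sink e) r' = sym (sink-output e r')
  runs-agree agree (step e r) (at-sink e') with () ← trans (sym e) e'
  runs-agree {x} {y} agree (step {v = v} {j₀} {j₁} e r) (step e' r') with refl ← trans (sym e) e' =
    runs-agree (λ p → All.tail (agree (edge (x v) e p))) r
      (subst (λ b → Run P y (if b then j₁ else j₀) _) (sym xv≡yv) r')
    where xv≡yv = All.head (agree (edge (x v) e (proj₂ (path-to-sink _))))

  module _ (read-once : ReadOnce P) where

    walk-distinct : ∀ {bs k A} → Walk source bs k A → AllPairs _≢_ (vars A)
    walk-distinct {A = A} w = AllPairs-++⁻ˡ (vars A) (read-once _ (walk→path w (proj₂ (path-to-sink _))))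

    walk-fresh : ∀ {bs k A vs} → Walk source bs k A → PathToSink P k vs → All (_∉ vars A) vs
    walk-fresh {A = A} w p = AllPairs-++⇒∉ (vars A) (read-once _ (walk→path w p))

-- Mixed functions need large read-once branching programs

-- A variant of Jukna's m-mixedness in which the two partial assignments
-- may fix different sets of variables.
record Mixed {V : Set} (f : (V → Bool) → Set) (m : ℕ) : Set where
  field
    undetermined : ∀ A → AllPairs _≢_ (vars A) → length A ≤ m →
      ∃₂ λ x y → Extends x A × Extends y A × ¬ f x × f y
    separable : ∀ A A' → AllPairs _≢_ (vars A) → AllPairs _≢_ (vars A') → Disagree A A' →
      length A ≤ m → length A' ≤ m →
      ∃₂ λ x y → Extends x A × Extends y A' ×
                 (∀ s → s ∉ vars A → s ∉ vars A' → x s ≡ y s) × ¬ f x × f y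

module _ {V : Set} {f : (V → Bool) → Set} (P : BP V) (computes : Computes P f) where
  open BP P

  computes-true : ∀ {x} → f x → Run P x source true
  computes-true {x} fx = [ proj₁ , (λ (_ , ¬fx) → contradiction fx ¬fx) ]′ (computes x)

  computes-false : ∀ {x} → ¬ f x → Run P x source false
  computes-false {x} ¬fx = [ (λ (_ , fx) → contradiction fx ¬fx) , proj₁ ]′ (computes x)

  sink-exists : ∃₂ λ k c → label k ≡ sink c
  sink-exists with computes (λ _ → true)
  ... | inj₁ (r , _) = -, -, proj₂ (run-sink P r)
  ... | inj₂ (r , _) = -, -, proj₂ (run-sink P r)

module _ {V : Set} {f : (V → Bool) → Set} {m : ℕ} (mixed : Mixed f m)
         (P : BP V) (read-once : ReadOnce P) (computes : Computes P f) where
  open BP P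
  open Mixed mixed

  assigned≤ : ∀ {i bs k A} → Walk P i bs k A → length bs ≤ m → length A ≤ m
  assigned≤ w = subst (_≤ m) (sym (walk-length P w))

  short-walk-avoids-sinks : ∀ {bs k A c} → Walk P source bs k A → length bs ≤ m → label k ≢ sink c
  short-walk-avoids-sinks {A = A} w h e
    with x , y , x⊇A , y⊇A , ¬fx , fy ← undetermined A (walk-distinct P read-once w) (assigned≤ w h) =
    contradiction (trans (sink-output P e (follow P x⊇A w (computes-false P computes ¬fx)))
                         (sym (sink-output P e (follow P y⊇A w (computes-true P computes fy)))))
                  λ ()

  disagreeing-short-walks-apart : ∀ {bs bs' k A A'} → Walk P source bs k A → Walk P source bs' k A' →
                                  Disagree A A' → length bs ≤ m → length bs' ≤ m → ⊥
  disagreeing-short-walks-apart {A = A} {A' = A'} w w' dis h h'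
    with x , y , x⊇A , y⊇A' , agreeOff , ¬fx , fy ←
           separable A A' (walk-distinct P read-once w) (walk-distinct P read-once w') dis
                     (assigned≤ w h) (assigned≤ w' h') =
    contradiction (runs-agree P agree (follow P x⊇A w (computes-false P computes ¬fx))
                                       (follow P y⊇A' w' (computes-true P computes fy)))
                  λ ()
    where
    agree : ∀ {vs} → PathToSink P _ vs → All (λ v → x v ≡ y v) vs
    agree p = All.zipWith (uncurry (agreeOff _)) (walk-fresh P read-once w p , walk-fresh P read-once w' p)

  distinct-short-walks-apart : ∀ {bs bs' k A A'} → Walk P source bs k A → Walk P source bs' k A' →
                               bs ≢ bs' → length bs ≤ m → length bs' ≤ m → ⊥
  distinct-short-walks-apart w w' bs≢bs' h h' with walks-disagree P w w' bs≢bs'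
  ... | inj₁ dis = disagreeing-short-walks-apart w w' dis h h'
  ... | inj₂ dis = disagreeing-short-walks-apart w' w dis h' h

  walk-exists : ∀ {cs i C} → Walk P source cs i C → ∀ bs → length (cs ++ bs) ≤ m →
                ∃₂ λ k A → Walk P i bs k A
  walk-exists w []       _ = -, -, stay
  walk-exists {cs} {i} w (b ∷ bs) h with label i in e
  ... | sink _ = contradiction e (short-walk-avoids-sinks w (≤-trans (length-++-≤ˡ cs) h))
  ... | query v j₀ j₁
    with k , A , w' ←
           walk-exists (walk-snoc P w e b) bs (subst (λ l → length l ≤ m) (sym (∷ʳ-++ cs b bs)) h) =
    k , -, move b e w'

  endpoint : Bits≤ m → Fin size
  endpoint (bs , h) = proj₁ (walk-exists stay bs h)

  endpoint-injective : Injective _≡_ _≡_ endpoint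
  endpoint-injective {bs , h} {bs' , h'} e with List-≡-dec _≟ᵇ_ bs bs'
  ... | yes refl = cong (bs ,_) (≤-irrelevant h h')
  ... | no bs≢bs' with walk-exists stay bs h | walk-exists stay bs' h' | e
  ...   | _ , _ , w | _ , _ , w' | refl = ⊥-elim (distinct-short-walks-apart w w' bs≢bs' h h')

  endpoint-not-sink : ∀ {k c} → label k ≡ sink c → ∀ s → endpoint s ≢ k
  endpoint-not-sink e (bs , h) eq with walk-exists stay bs h | eq
  ... | _ , _ , w | refl = short-walk-avoids-sinks w h e

  size≥ : 2 ^ suc m ≤ size
  size≥ with k , _ , e ← sink-exists P computes =
    Bits≤-injection⇒≤ (maybe′ endpoint k) (maybe′-injective endpoint-injective (endpoint-not-sink e))

mixed⇒BP₁≥ : ∀ {V : Set} {f : (V → Bool) → Set} {m} → Mixed f m → BP₁≥ f (2 ^ suc m)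
mixed⇒BP₁≥ = size≥

-- Non-vertical lines over a finite field

module _ (F : FiniteField) where
  open FiniteField F using (Carrier; q; enum; inverse; 0≢1; isCommutativeRing)
  open Inverse enum using (to; from; strictlyInverseˡ; strictlyInverseʳ)

  commutativeRing : Bundles.CommutativeRing 0ℓ 0ℓ
  commutativeRing = record { isCommutativeRing = isCommutativeRing }

  open Bundles.CommutativeRing commutativeRing
    using (_+_; _*_; _-_; 0#; 1#; +-assoc; +-comm; +-identityʳ; *-identityʳ; *-assoc;
           distribˡ; zeroˡ; +-group)
  open GroupProperties +-group using (∙-cancelˡ; ∙-cancelʳ; //-rightDividesˡ; x∙y⁻¹≈ε⇒x≈y)

  infix 4 _≟_
  _≟_ : DecidableEquality Carrier
  _≟_ = inj⇒≟ (↔⇒↣ enum)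

  open DecMembership _≟_ using (_∈?_)

  to-injective : Injective _≡_ _≡_ to
  to-injective {x} {y} e = trans (sym (strictlyInverseʳ x)) (trans (cong from e) (strictlyInverseʳ y))

  from-injective : Injective _≡_ _≡_ from
  from-injective {i} {j} e = trans (sym (strictlyInverseˡ i)) (trans (cong to e) (strictlyInverseˡ j))

  2≤q : 2 ≤ q
  2≤q = injective⇒≤ {f = to ∘ bit} (bit-injective ∘ to-injective)
    where
    bit : Fin 2 → Carrier
    bit 0F = 0#
    bit 1F = 1#
    bit-injective : Injective _≡_ _≡_ bit
    bit-injective {0F} {0F} _ = refl
    bit-injective {1F} {1F} _ = refl
    bit-injective {0F} {1F} e = contradiction e 0≢1
    bit-injective {1F} {0F} e = contradiction (sym e) 0≢1

  fresh : (xs : List Carrier) → length xs < q → ∃[ c ] c ∉ xs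
  fresh xs ∣xs∣<q with all? (λ i → from i ∈? xs)
  ... | no ¬all with i , i∉ ← ¬∀⟶∃¬ q _ (λ i → from i ∈? xs) ¬all = from i , i∉
  ... | yes all = contradiction (injective⇒≤ {f = index ∘ all} position-injective) (<⇒≱ ∣xs∣<q)
    where
    position-injective : Injective _≡_ _≡_ (index ∘ all)
    position-injective {i} {j} e =
      from-injective (trans (lookup-index (all i)) (trans (cong (lookup xs) e) (sym (lookup-index (all j)))))

  fresh₂ : (xs : List Carrier) → 2 ℕ.+ length xs ≤ q → ∃₂ λ t t' → t ∉ xs × t' ∉ xs × t ≢ t'
  fresh₂ xs h with t , t∉ ← fresh xs (≤-trans (n≤1+n _) h) with t' , t'∉ ← fresh (t ∷ xs) h =
    t , t' , t∉ , t'∉ ∘ there , t'∉ ∘ here ∘ sym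

  -- A c with R c x, if there is one (0# otherwise).
  choose : ∀ {X : Set} {R : Carrier → X → Set} → (∀ c x → Dec (R c x)) → X → Carrier
  choose R? x with any? (λ i → R? (from i) x)
  ... | yes (i , _) = from i
  ... | no _        = 0#

  choose-related : ∀ {X : Set} {R : Carrier → X → Set} (R? : ∀ c x → Dec (R c x)) {c x} →
                   R c x → R (choose R? x) x
  choose-related {R = R} R? {c} {x} Rcx with any? (λ i → R? (from i) x)
  ... | yes (_ , Rix) = Rix
  ... | no ¬∃         = contradiction (to c , subst (λ c → R c x) (sym (strictlyInverseʳ c)) Rcx) ¬∃

  unrelated-exists : ∀ {X : Set} (R : Carrier → X → Set) (R? : ∀ c x → Dec (R c x)) →
          (∀ {c c' x} → R c x → R c' x → c ≡ c') →
          (xs : List X) → length xs < q → ∃[ c ] All (λ x → ¬ R c x) xs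
  unrelated-exists R R? R-functional xs ∣xs∣<q
    with c , c∉ ← fresh (map (choose R?) xs) (subst (_< q) (sym (length-map (choose R?) xs)) ∣xs∣<q) =
    c , All.tabulate λ x∈xs Rcx →
          c∉ (subst (_∈ map (choose R?) xs) (sym (R-functional Rcx (choose-related R? Rcx)))
                    (∈-map⁺ (choose R?) x∈xs))

  *-cancelʳ-nonzero : ∀ {x y d} → d ≢ 0# → x * d ≡ y * d → x ≡ y
  *-cancelʳ-nonzero {x} {y} {d} d≢0 xd≡yd with d⁻¹ , dd⁻¹≡1 ← inverse d d≢0 = begin
    x              ≡⟨ *-identityʳ x ⟨
    x * 1#         ≡⟨ cong (x *_) dd⁻¹≡1 ⟨
    x * (d * d⁻¹)  ≡⟨ *-assoc x d d⁻¹ ⟨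
    x * d * d⁻¹    ≡⟨ cong (_* d⁻¹) xd≡yd ⟩
    y * d * d⁻¹    ≡⟨ *-assoc y d d⁻¹ ⟩
    y * (d * d⁻¹)  ≡⟨ cong (y *_) dd⁻¹≡1 ⟩
    y * 1#         ≡⟨ *-identityʳ y ⟩
    y              ∎
    where open ≡-Reasoning

  onLine? : ∀ a L → Dec (OnLine F a L)
  onLine? (a₁ , a₂) (i , j) = a₂ ≟ i + j * a₁

  pointAt : Point F → Carrier → Point F
  pointAt (i , j) t = t , i + j * t

  through : Point F → Carrier → Point F
  through (p₁ , p₂) j = p₂ - j * p₁ , j

  on-through : ∀ p j → OnLine F p (through p j)
  on-through (p₁ , p₂) j = sym (//-rightDividesˡ (j * p₁) p₂)

  same-abscissa : ∀ {a b L} → OnLine F a L → OnLine F b L → proj₁ a ≡ proj₁ b → a ≡ b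
  same-abscissa {a₁ , _} {_ , _} {_ , _} a∈L b∈L refl = cong (a₁ ,_) (trans a∈L (sym b∈L))

  lines-meet-once : ∀ {a b L L'} → proj₁ a ≢ proj₁ b →
                    OnLine F a L → OnLine F b L → OnLine F a L' → OnLine F b L' → L ≡ L'
  lines-meet-once {a₁ , a₂} {b₁ , b₂} {i , j} {i' , j'} a₁≢b₁ a∈L b∈L a∈L' b∈L' =
    cong₂ _,_ intercepts slopes
    where
    open ≡-Reasoning
    d = a₁ - b₁
    shift : ∀ i j → i + j * a₁ ≡ i + j * b₁ + j * d
    shift i j = begin
      i + j * a₁             ≡⟨ cong (λ t → i + j * t) (//-rightDividesˡ b₁ a₁) ⟨
      i + j * (d + b₁)       ≡⟨ cong (i +_) (trans (distribˡ j d b₁) (+-comm (j * d) (j * b₁))) ⟩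
      i + (j * b₁ + j * d)   ≡⟨ +-assoc i (j * b₁) (j * d) ⟨
      i + j * b₁ + j * d     ∎
    slopes : j ≡ j'
    slopes = *-cancelʳ-nonzero (a₁≢b₁ ∘ x∙y⁻¹≈ε⇒x≈y a₁ b₁) (∙-cancelˡ b₂ (j * d) (j' * d) (begin
      b₂ + j * d             ≡⟨ cong (_+ j * d) b∈L ⟩
      i + j * b₁ + j * d     ≡⟨ shift i j ⟨
      i + j * a₁             ≡⟨ trans (sym a∈L) a∈L' ⟩
      i' + j' * a₁           ≡⟨ shift i' j' ⟩
      i' + j' * b₁ + j' * d  ≡⟨ cong (_+ j' * d) b∈L' ⟨
      b₂ + j' * d            ∎))
    intercepts : i ≡ i'
    intercepts = ∙-cancelʳ (j * a₁) i i'
                   (trans (sym a∈L) (trans a∈L' (cong (λ j → i' + j * a₁) (sym slopes))))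

  through-slope-unique : ∀ {p s j j'} → s ≢ p →
                         OnLine F s (through p j) → OnLine F s (through p j') → j ≡ j'
  through-slope-unique {p} {s} {j} {j'} s≢p s∈L s∈L' with proj₁ s ≟ proj₁ p
  ... | yes same = contradiction (same-abscissa s∈L (on-through p j) same) s≢p
  ... | no  differ = cong proj₂ (lines-meet-once differ s∈L (on-through p j) s∈L' (on-through p j'))

-- GAL is (q − 2)-mixed

  _≟ₚ_ : DecidableEquality (Point F)
  _≟ₚ_ = ≡-dec _≟_ _≟_

  open DecMembership _≟ₚ_ using () renaming (_∈?_ to _∈ₚ?_)

  assign : List (Point F × Bool) → (Point F → Bool) → Point F → Bool
  assign = override _≟ₚ_

  zeroOn : Point F → Point F → Bool
  zeroOn L s = not (does (onLine? s L))

  zeroOn-on : ∀ {L s} → OnLine F s L → zeroOn L s ≡ false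
  zeroOn-on {L} {s} s∈L rewrite dec-true (onLine? s L) s∈L = refl

  zeroOn-off : ∀ {L s} → ¬ OnLine F s L → zeroOn L s ≡ true
  zeroOn-off {L} {s} s∉L rewrite dec-false (onLine? s L) s∉L = refl

  ¬GAL-zeroOn : ∀ A L → AllPairs _≢_ (vars A) → (∀ {s b} → (s , b) ∈ A → OnLine F s L → b ≡ false) →
                ¬ GAL F (assign A (zeroOn L))
  ¬GAL-zeroOn A L distinct false-on-L gal with a , a∈L , xa≡true ← gal L with a ∈ₚ? vars A
  ... | yes a∈A with _ , ab∈A , refl ← ∈-map⁻ proj₁ a∈A =
    contradiction (trans (sym xa≡true) (trans (All.lookup (override-extends _≟ₚ_ A _ distinct) ab∈A)
                                              (false-on-L ab∈A a∈L)))
                  λ ()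
  ... | no a∉A =
    contradiction (trans (sym xa≡true) (trans (override-∉ _≟ₚ_ A _ a∉A) (zeroOn-on a∈L))) λ ()

  -- A line L' ≠ L has two points with fresh abscissae; they are not both on L.
  GAL-true-off-line : ∀ (ps : List (Point F)) L p (x : Point F → Bool) → 2 ℕ.+ length ps ≤ q →
                      (∀ s → s ∉ ps → ¬ OnLine F s L → x s ≡ true) → OnLine F p L → x p ≡ true →
                      GAL F x
  GAL-true-off-line ps L p x room true-off-L p∈L xp≡true L'@(i , j) with L' ≟ₚ L
  ... | yes refl = p , p∈L , xp≡true
  ... | no L'≢L
    with t , t' , t∉ , t'∉ , t≢t' ←
           fresh₂ (map proj₁ ps) (subst (λ n → 2 ℕ.+ n ≤ q) (sym (length-map proj₁ ps)) room)
    with onLine? (pointAt L' t) L | onLine? (pointAt L' t') L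
  ... | no off | _       = pointAt L' t  , refl , true-off-L _ (t∉ ∘ ∈-map⁺ proj₁) off
  ... | _      | no off  = pointAt L' t' , refl , true-off-L _ (t'∉ ∘ ∈-map⁺ proj₁) off
  ... | yes on | yes on' =
    contradiction (lines-meet-once {pointAt L' t} {pointAt L' t'} t≢t' refl refl on on') L'≢L

  horizontal-height : ∀ {s c} → OnLine F s (c , 0#) → proj₂ s ≡ c
  horizontal-height {s₁ , _} {c} s∈H = trans s∈H (trans (cong (c +_) (zeroˡ s₁)) (+-identityʳ c))

  room : ∀ (A : List (Point F × Bool)) → length A ≤ q ∸ 2 → 2 ℕ.+ length (vars A) ≤ q
  room A h = subst (λ n → 2 ℕ.+ n ≤ q) (sym (length-map proj₁ A))
                   (≤-trans (+-monoʳ-≤ 2 h) (≤-reflexive (m+[n∸m]≡n 2≤q)))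

  GAL-undetermined : ∀ A → AllPairs _≢_ (vars A) → length A ≤ q ∸ 2 →
                     ∃₂ λ x y → Extends x A × Extends y A × ¬ GAL F x × GAL F y
  GAL-undetermined A distinct h
    with c , c∉ ← fresh (map proj₂ (vars A))
                        (subst (_< q) (sym (length-map proj₂ (vars A))) (≤-trans (n≤1+n _) (room A h))) =
    assign A (zeroOn H) , assign A (λ _ → true) ,
    override-extends _≟ₚ_ A _ distinct , override-extends _≟ₚ_ A _ distinct ,
    ¬GAL-zeroOn A H distinct (λ sb∈A s∈H → contradiction (∈-map⁺ proj₁ sb∈A) (unassigned s∈H)) ,
    GAL-true-off-line (vars A) H (pointAt H 0#) _ (room A h)
      (λ _ s∉A _ → override-∉ _≟ₚ_ A _ s∉A) refl (override-∉ _≟ₚ_ A _ (unassigned refl))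
    where
    H = c , 0#
    unassigned : ∀ {s} → OnLine F s H → s ∉ vars A
    unassigned s∈H s∈A = c∉ (subst (_∈ map proj₂ (vars A)) (horizontal-height s∈H) (∈-map⁺ proj₂ s∈A))

  GAL-separable : ∀ A A' → AllPairs _≢_ (vars A) → AllPairs _≢_ (vars A') → Disagree A A' →
                  length A ≤ q ∸ 2 → length A' ≤ q ∸ 2 →
                  ∃₂ λ x y → Extends x A × Extends y A' ×
                             (∀ s → s ∉ vars A → s ∉ vars A' → x s ≡ y s) × ¬ GAL F x × GAL F y
  GAL-separable A A' distinct distinct' (p , pfalse∈A , ptrue∈A') h h'
    with j , avoids ← unrelated-exists (λ j s → s ≢ p × OnLine F s (through p j))
                                       (λ j s → ¬? (s ≟ₚ p) ×-dec onLine? s (through p j))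
                                       (λ (s≢p , s∈L) (_ , s∈L') → through-slope-unique s≢p s∈L s∈L')
                                       (vars A) (≤-trans (n≤1+n _) (room A h)) =
    assign A (zeroOn L) , assign A' (zeroOn L) , x⊇A , y⊇A' ,
    (λ s s∉A s∉A' → trans (override-∉ _≟ₚ_ A _ s∉A) (sym (override-∉ _≟ₚ_ A' _ s∉A'))) ,
    ¬GAL-zeroOn A L distinct only-p-on-L ,
    GAL-true-off-line (vars A') L p _ (room A' h')
      (λ s s∉A' s∉L → trans (override-∉ _≟ₚ_ A' _ s∉A') (zeroOn-off s∉L))
      (on-through p j) (All.lookup y⊇A' ptrue∈A')
    where
    L = through p j
    x⊇A = override-extends _≟ₚ_ A (zeroOn L) distinct
    y⊇A' = override-extends _≟ₚ_ A' (zeroOn L) distinct'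
    only-p-on-L : ∀ {s b} → (s , b) ∈ A → OnLine F s L → b ≡ false
    only-p-on-L {s} sb∈A s∈L with s ≟ₚ p
    ... | yes refl = trans (sym (All.lookup x⊇A sb∈A)) (All.lookup x⊇A pfalse∈A)
    ... | no  s≢p  = contradiction (s≢p , s∈L) (All.lookup avoids (∈-map⁺ proj₁ sb∈A))

  GAL-mixed : Mixed (GAL F) (q ∸ 2)
  GAL-mixed = record { undetermined = GAL-undetermined ; separable = GAL-separable }

corollary6p5 : ∀ (F : FiniteField) →
    BP₁≥ (GAL F) (2 ^ (FiniteField.q F ∸ 1))
corollary6p5 F = subst (BP₁≥ (GAL F) ∘ (2 ^_)) (sym q∸1≡1+[q∸2]) (mixed⇒BP₁≥ (GAL-mixed F))
  where q∸1≡1+[q∸2] = cong (_∸ 1) (sym (m+[n∸m]≡n (2≤q F)))
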